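{- Let $p(x,y)=\sum_{i,j\ge0}a_{i,j}x^iy^j$ be a polynomial in two variables with coefficients in a commutative ring, and for an integer $k\ge 0$ define $$I_k(p(x,y))=\sum_{i=0}^k\sum_{j=0}^{k-i}(-1)^j\binom{k-i}{j}a_{i,j}.$$ Then: (1) $I_k(x^m p(x,y))=I_{k-m}(p(x,y))$ for all integers $0\le m\le k$; (2) $I_k(y\cdot p(x,y))=-\sum_{s=0}^{k-1}I_s(p(x,y))$.
   Context: Here $a_{i,j}$ is the coefficient of $x^iy^j$ in $p$, and $I_k$ applied to any polynomial uses that polynomial's coefficients in the same formula. -}

module Defs where

open import Level using (Level)
open import Data.Nat as ℕ using (ℕ; zero; suc; _∸_; _≤_; _<_)
open import Data.Nat.Combinatorics using (_C_)
open import Data.Product using (Σ)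
open import Data.Sum using (_⊎_)
open import Relation.Nullary using (yes; no)
open import Algebra.Bundles using (CommutativeRing; Semiring)
import Algebra.Definitions.RawSemiring as RS

module Poly {c ℓ : Level} (R : CommutativeRing c ℓ) where
  open CommutativeRing R
  open RS (Semiring.rawSemiring semiring) using (_×_; _^_)

  -- A polynomial in x, y over R is given by its coefficient function
  -- (i , j) ↦ a_{i,j}, the coefficient of x^i y^j, with finite support.
  Coeffs : Set c
  Coeffs = ℕ → ℕ → Carrier

  IsPoly : Coeffs → Set ℓ
  IsPoly a = Σ ℕ λ N → ∀ i j → (N ≤ i ⊎ N ≤ j) → a i j ≈ 0#

  sumTo : ℕ → (ℕ → Carrier) → Carrier
  sumTo zero    f = f 0
  sumTo (suc n) f = sumTo n f + f (suc n)

  sumBelow : ℕ → (ℕ → Carrier) → Carrier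
  sumBelow zero    f = 0#
  sumBelow (suc n) f = sumBelow n f + f n

  I : ℕ → Coeffs → Carrier
  I k a = sumTo k λ i → sumTo (k ∸ i) λ j →
            ((- 1#) ^ j) * (((k ∸ i) C j) × a i j)

  xPow : ℕ → Coeffs → Coeffs
  xPow m a i j with m ℕ.≤? i
  ... | yes _ = a (i ∸ m) j
  ... | no  _ = 0#

  yMul : Coeffs → Coeffs
  yMul a i zero    = 0#
  yMul a i (suc j) = a i j

-- Write I_k(p) = Σ_{i ≤ k} B_{k-i}(a_{i,·}), where B_n(g) = Σ_{j ≤ n} (-1)^j C(n,j) g_j
-- is an alternating binomial sum of the i-th row of coefficients. Multiplying by
-- x^m moves the rows up by m, so the rows i < m vanish and reindexing gives (1).
-- Multiplying by y shifts every row to the right; for a shifted row h, Pascal's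
-- rule gives B_{n+1}(h) = B_n(h) - B_n(g), hence B_n(h) = - Σ_{s < n} B_s(g).
-- Summing over i and interchanging the sums over the triangle i + s < k gives (2).
module Submission where

open import Defs
open import Level using (Level)
open import Data.Nat as ℕ using (ℕ; zero; suc; _≤_; _<_; _∸_; _≤?_; z≤n)
open import Data.Nat.Properties
  using (≤-refl; m≤n⇒m≤1+n; m<n⇒m<1+n; n<1+n; <⇒≱; m≤m+n; m+n∸m≡n; [m+n]∸[m+o]≡n∸o; m+[n∸m]≡n; n∸n≡0; +-∸-assoc)
open import Data.Nat.Combinatorics using (_C_; nCk+nC[k+1]≡[n+1]C[k+1]; k>n⇒nCk≡0)
open import Data.Product using (_×_; _,_)
open import Algebra.Bundles using (CommutativeRing; Semiring)
open import Relation.Nullary using (yes; no)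
open import Relation.Nullary.Negation using (contradiction)
import Relation.Binary.PropositionalEquality as ≡
import Algebra.Definitions.RawSemiring as RawSemiringDefinitions
import Algebra.Properties.Ring as RingProperties
import Algebra.Properties.Monoid.Mult as MonoidMultProperties
import Relation.Binary.Reasoning.Setoid as SetoidReasoning

module _ {c ℓ : Level} (R : CommutativeRing c ℓ) where
  open CommutativeRing R
  open Poly R
  open RawSemiringDefinitions (Semiring.rawSemiring semiring) using (_^_) renaming (_×_ to _·_)
  open MonoidMultProperties +-monoid using (×-congʳ; ×-congˡ; ×-homo-+)
  open RingProperties ring using (-1*x≈-x; -0#≈0#; -‿+-comm)
  open SetoidReasoning setoid

  sumTo-cong : ∀ n {f g : ℕ → Carrier} → (∀ i → f i ≈ g i) → sumTo n f ≈ sumTo n g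
  sumTo-cong zero    f≈g = f≈g 0
  sumTo-cong (suc n) f≈g = +-cong (sumTo-cong n f≈g) (f≈g (suc n))

  sumTo-cong-≤ : ∀ n {f g : ℕ → Carrier} → (∀ i → i ≤ n → f i ≈ g i) → sumTo n f ≈ sumTo n g
  sumTo-cong-≤ zero    f≈g = f≈g 0 z≤n
  sumTo-cong-≤ (suc n) f≈g =
    +-cong (sumTo-cong-≤ n (λ i i≤n → f≈g i (m≤n⇒m≤1+n i≤n))) (f≈g (suc n) ≤-refl)

  sumTo-distrib-+ : ∀ n (f g : ℕ → Carrier) →
                    sumTo n (λ i → f i + g i) ≈ sumTo n f + sumTo n g
  sumTo-distrib-+ zero    f g = refl
  sumTo-distrib-+ (suc n) f g = begin
    sumTo n (λ i → f i + g i) + (f (suc n) + g (suc n))  ≈⟨ +-congʳ (sumTo-distrib-+ n f g) ⟩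
    (sumTo n f + sumTo n g) + (f (suc n) + g (suc n))    ≈⟨ +-assoc _ _ _ ⟩
    sumTo n f + (sumTo n g + (f (suc n) + g (suc n)))    ≈⟨ +-congˡ (+-assoc _ _ _) ⟨
    sumTo n f + ((sumTo n g + f (suc n)) + g (suc n))    ≈⟨ +-congˡ (+-congʳ (+-comm _ _)) ⟩
    sumTo n f + ((f (suc n) + sumTo n g) + g (suc n))    ≈⟨ +-congˡ (+-assoc _ _ _) ⟩
    sumTo n f + (f (suc n) + (sumTo n g + g (suc n)))    ≈⟨ +-assoc _ _ _ ⟨
    (sumTo n f + f (suc n)) + (sumTo n g + g (suc n))    ∎

  sumTo-neg : ∀ n (f : ℕ → Carrier) → sumTo n (λ i → - f i) ≈ - sumTo n f
  sumTo-neg zero    f = refl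
  sumTo-neg (suc n) f = trans (+-congʳ (sumTo-neg n f)) (-‿+-comm _ _)

  sumTo-unfoldˡ : ∀ n (f : ℕ → Carrier) → sumTo (suc n) f ≈ f 0 + sumTo n (λ i → f (suc i))
  sumTo-unfoldˡ zero    f = refl
  sumTo-unfoldˡ (suc n) f = trans (+-congʳ (sumTo-unfoldˡ n f)) (+-assoc _ _ _)

  sumBelow-unfoldˡ : ∀ n (f : ℕ → Carrier) → sumBelow (suc n) f ≈ f 0 + sumBelow n (λ i → f (suc i))
  sumBelow-unfoldˡ zero    f = +-comm _ _
  sumBelow-unfoldˡ (suc n) f = trans (+-congʳ (sumBelow-unfoldˡ n f)) (+-assoc _ _ _)

  sumBelow-zero : ∀ n {f : ℕ → Carrier} → (∀ i → i < n → f i ≈ 0#) → sumBelow n f ≈ 0#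
  sumBelow-zero zero    f≈0 = refl
  sumBelow-zero (suc n) f≈0 =
    trans (+-cong (sumBelow-zero n (λ i i<n → f≈0 i (m<n⇒m<1+n i<n))) (f≈0 n ≤-refl))
          (+-identityˡ 0#)

  sumTo-splitAt : ∀ m n (f : ℕ → Carrier) →
                  sumTo (m ℕ.+ n) f ≈ sumBelow m f + sumTo n (λ i → f (m ℕ.+ i))
  sumTo-splitAt zero    n f = sym (+-identityˡ _)
  sumTo-splitAt (suc m) n f = begin
    sumTo (suc (m ℕ.+ n)) f
      ≈⟨ sumTo-unfoldˡ (m ℕ.+ n) f ⟩
    f 0 + sumTo (m ℕ.+ n) (λ i → f (suc i))
      ≈⟨ +-congˡ (sumTo-splitAt m n (λ i → f (suc i))) ⟩
    f 0 + (sumBelow m (λ i → f (suc i)) + sumTo n (λ i → f (suc (m ℕ.+ i))))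
      ≈⟨ +-assoc _ _ _ ⟨
    (f 0 + sumBelow m (λ i → f (suc i))) + sumTo n (λ i → f (suc (m ℕ.+ i)))
      ≈⟨ +-congʳ (sumBelow-unfoldˡ m f) ⟨
    sumBelow (suc m) f + sumTo n (λ i → f (suc m ℕ.+ i)) ∎

  -- Σ_{i ≤ k} Σ_{t < k-i} F i t and Σ_{s < k} Σ_{i ≤ s} F i (s-i) both run
  -- over the pairs (i , t) with i + t < k.
  sumTo-sumBelow-swap : ∀ k (F : ℕ → ℕ → Carrier) →
    sumTo k (λ i → sumBelow (k ∸ i) (F i)) ≈ sumBelow k (λ s → sumTo s (λ i → F i (s ∸ i)))
  sumTo-sumBelow-swap zero    F = refl
  sumTo-sumBelow-swap (suc k) F = begin
    sumTo k (λ i → sumBelow (suc k ∸ i) (F i)) + sumBelow (k ∸ k) (F (suc k))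
      ≈⟨ +-cong (sumTo-cong-≤ k peelLast) (reflexive (≡.cong (λ t → sumBelow t (F (suc k))) (n∸n≡0 k))) ⟩
    sumTo k (λ i → sumBelow (k ∸ i) (F i) + F i (k ∸ i)) + 0#
      ≈⟨ +-identityʳ _ ⟩
    sumTo k (λ i → sumBelow (k ∸ i) (F i) + F i (k ∸ i))
      ≈⟨ sumTo-distrib-+ k _ _ ⟩
    sumTo k (λ i → sumBelow (k ∸ i) (F i)) + sumTo k (λ i → F i (k ∸ i))
      ≈⟨ +-congʳ (sumTo-sumBelow-swap k F) ⟩
    sumBelow (suc k) (λ s → sumTo s (λ i → F i (s ∸ i))) ∎
    where
    peelLast : ∀ i → i ≤ k → sumBelow (suc k ∸ i) (F i) ≈ sumBelow (k ∸ i) (F i) + F i (k ∸ i)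
    peelLast i i≤k rewrite +-∸-assoc 1 i≤k = refl

  ·-zeroʳ : ∀ n → n · 0# ≈ 0#
  ·-zeroʳ zero    = refl
  ·-zeroʳ (suc n) = trans (+-identityˡ _) (·-zeroʳ n)

  alternatingBinomialSum : ℕ → (ℕ → Carrier) → Carrier
  alternatingBinomialSum n g = sumTo n (λ j → ((- 1#) ^ j) * ((n C j) · g j))

  alternatingBinomialSum-cong : ∀ n {g h : ℕ → Carrier} → (∀ j → g j ≈ h j) →
                                alternatingBinomialSum n g ≈ alternatingBinomialSum n h
  alternatingBinomialSum-cong n g≈h = sumTo-cong n (λ j → *-congˡ (×-congʳ (n C j) (g≈h j)))

  alternatingBinomialTerm-zero : ∀ j n {x} → x ≈ 0# → ((- 1#) ^ j) * (n · x) ≈ 0#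
  alternatingBinomialTerm-zero j n x≈0 = trans (*-congˡ (trans (×-congʳ n x≈0) (·-zeroʳ n))) (zeroʳ _)

  alternatingBinomialSum-zero : ∀ n {g : ℕ → Carrier} → (∀ j → g j ≈ 0#) →
                                alternatingBinomialSum n g ≈ 0#
  alternatingBinomialSum-zero n {g} g≈0 = go n
    where
    go : ∀ t → sumTo t (λ j → ((- 1#) ^ j) * ((n C j) · g j)) ≈ 0#
    go zero    = alternatingBinomialTerm-zero 0 (n C 0) (g≈0 0)
    go (suc t) = trans (+-cong (go t) (alternatingBinomialTerm-zero (suc t) (n C suc t) (g≈0 (suc t))))
                       (+-identityˡ 0#)

  module _ {g h : ℕ → Carrier} (h₀≈0 : h 0 ≈ 0#) (h∘suc≈g : ∀ j → h (suc j) ≈ g j) where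

    private
      term : ℕ → ℕ → Carrier
      term n j = ((- 1#) ^ j) * ((n C j) · h j)

    alternatingBinomialSum-reindex : ∀ n →
      sumTo n (λ j → term n (suc j)) ≈ alternatingBinomialSum n h
    alternatingBinomialSum-reindex n = begin
      sumTo n (λ j → term n (suc j))                ≈⟨ +-identityˡ _ ⟨
      0# + sumTo n (λ j → term n (suc j))           ≈⟨ +-congʳ (alternatingBinomialTerm-zero 0 (n C 0) h₀≈0) ⟨
      term n 0 + sumTo n (λ j → term n (suc j))     ≈⟨ sumTo-unfoldˡ n (term n) ⟨
      sumTo n (term n) + term n (suc n)             ≈⟨ +-congˡ lastTerm ⟩
      sumTo n (term n) + 0#                         ≈⟨ +-identityʳ _ ⟩
      alternatingBinomialSum n h                    ∎
      where
      lastTerm : term n (suc n) ≈ 0#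
      lastTerm = trans (*-congˡ (reflexive (≡.cong (_· h (suc n)) (k>n⇒nCk≡0 (n<1+n n))))) (zeroʳ _)

    pascal-term : ∀ n j →
      term (suc n) (suc j) ≈ - (((- 1#) ^ j) * ((n C j) · g j)) + term n (suc j)
    pascal-term n j = begin
      (- 1# * (- 1#) ^ j) * ((suc n C suc j) · h (suc j))
        ≈⟨ *-congˡ (×-congˡ (≡.sym (nCk+nC[k+1]≡[n+1]C[k+1] n j))) ⟩
      (- 1# * (- 1#) ^ j) * ((n C j ℕ.+ n C suc j) · h (suc j))
        ≈⟨ *-congˡ (×-homo-+ (h (suc j)) (n C j) (n C suc j)) ⟩
      (- 1# * (- 1#) ^ j) * ((n C j) · h (suc j) + (n C suc j) · h (suc j))
        ≈⟨ distribˡ _ _ _ ⟩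
      (- 1# * (- 1#) ^ j) * ((n C j) · h (suc j)) + term n (suc j)
        ≈⟨ +-congʳ (trans (*-assoc _ _ _) (-1*x≈-x _)) ⟩
      - (((- 1#) ^ j) * ((n C j) · h (suc j))) + term n (suc j)
        ≈⟨ +-congʳ (-‿cong (*-congˡ (×-congʳ (n C j) (h∘suc≈g j)))) ⟩
      - (((- 1#) ^ j) * ((n C j) · g j)) + term n (suc j) ∎

    alternatingBinomialSum-shift-suc : ∀ n →
      alternatingBinomialSum (suc n) h ≈ alternatingBinomialSum n h - alternatingBinomialSum n g
    alternatingBinomialSum-shift-suc n = begin
      alternatingBinomialSum (suc n) h
        ≈⟨ sumTo-unfoldˡ n (term (suc n)) ⟩
      term (suc n) 0 + sumTo n (λ j → term (suc n) (suc j))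
        ≈⟨ +-cong (alternatingBinomialTerm-zero 0 1 h₀≈0) (sumTo-cong n (pascal-term n)) ⟩
      0# + sumTo n (λ j → - (((- 1#) ^ j) * ((n C j) · g j)) + term n (suc j))
        ≈⟨ +-identityˡ _ ⟩
      sumTo n (λ j → - (((- 1#) ^ j) * ((n C j) · g j)) + term n (suc j))
        ≈⟨ sumTo-distrib-+ n _ _ ⟩
      sumTo n (λ j → - (((- 1#) ^ j) * ((n C j) · g j))) + sumTo n (λ j → term n (suc j))
        ≈⟨ +-cong (sumTo-neg n _) (alternatingBinomialSum-reindex n) ⟩
      - alternatingBinomialSum n g + alternatingBinomialSum n h
        ≈⟨ +-comm _ _ ⟩
      alternatingBinomialSum n h - alternatingBinomialSum n g ∎

    alternatingBinomialSum-shift : ∀ n →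
      alternatingBinomialSum n h ≈ - sumBelow n (λ s → alternatingBinomialSum s g)
    alternatingBinomialSum-shift zero    = trans (alternatingBinomialTerm-zero 0 1 h₀≈0) (sym -0#≈0#)
    alternatingBinomialSum-shift (suc n) =
      trans (alternatingBinomialSum-shift-suc n)
            (trans (+-congʳ (alternatingBinomialSum-shift n)) (-‿+-comm _ _))

  xPow-below : ∀ m (a : Coeffs) i j → i < m → xPow m a i j ≈ 0#
  xPow-below m a i j i<m with m ≤? i
  ... | yes m≤i = contradiction m≤i (<⇒≱ i<m)
  ... | no  _   = refl

  xPow-+ : ∀ m (a : Coeffs) i j → xPow m a (m ℕ.+ i) j ≈ a i j
  xPow-+ m a i j with m ≤? m ℕ.+ i
  ... | yes _ rewrite m+n∸m≡n m i = refl
  ... | no m≰m+i = contradiction (m≤m+n m i) m≰m+i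

  I-xPow-+ : ∀ (a : Coeffs) m n → I (m ℕ.+ n) (xPow m a) ≈ I n a
  I-xPow-+ a m n = begin
    sumTo (m ℕ.+ n) (λ i → alternatingBinomialSum (m ℕ.+ n ∸ i) (xPow m a i))
      ≈⟨ sumTo-splitAt m n _ ⟩
    sumBelow m (λ i → alternatingBinomialSum (m ℕ.+ n ∸ i) (xPow m a i))
      + sumTo n (λ i → alternatingBinomialSum (m ℕ.+ n ∸ (m ℕ.+ i)) (xPow m a (m ℕ.+ i)))
      ≈⟨ +-cong (sumBelow-zero m lowRow) (sumTo-cong n shiftedRow) ⟩
    0# + I n a
      ≈⟨ +-identityˡ _ ⟩
    I n a ∎
    where
    lowRow : ∀ i → i < m → alternatingBinomialSum (m ℕ.+ n ∸ i) (xPow m a i) ≈ 0#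
    lowRow i i<m = alternatingBinomialSum-zero (m ℕ.+ n ∸ i) (λ j → xPow-below m a i j i<m)

    shiftedRow : ∀ i → alternatingBinomialSum (m ℕ.+ n ∸ (m ℕ.+ i)) (xPow m a (m ℕ.+ i))
                       ≈ alternatingBinomialSum (n ∸ i) (a i)
    shiftedRow i rewrite [m+n]∸[m+o]≡n∸o m n i =
      alternatingBinomialSum-cong (n ∸ i) (xPow-+ m a i)

  I-xPow : ∀ (a : Coeffs) k m → m ≤ k → I k (xPow m a) ≈ I (k ∸ m) a
  I-xPow a k m m≤k = ≡.subst (λ t → I t (xPow m a) ≈ I (k ∸ m) a) (m+[n∸m]≡n m≤k) (I-xPow-+ a m (k ∸ m))

  I-yMul : ∀ (a : Coeffs) k → I k (yMul a) ≈ - sumBelow k (λ s → I s a)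
  I-yMul a k = begin
    sumTo k (λ i → alternatingBinomialSum (k ∸ i) (yMul a i))
      ≈⟨ sumTo-cong k (λ i → alternatingBinomialSum-shift refl (λ _ → refl) (k ∸ i)) ⟩
    sumTo k (λ i → - sumBelow (k ∸ i) (λ s → alternatingBinomialSum s (a i)))
      ≈⟨ sumTo-neg k _ ⟩
    - sumTo k (λ i → sumBelow (k ∸ i) (λ s → alternatingBinomialSum s (a i)))
      ≈⟨ -‿cong (sumTo-sumBelow-swap k (λ i s → alternatingBinomialSum s (a i))) ⟩
    - sumBelow k (λ s → I s a) ∎

lemma3p2 : ∀ {c ℓ : Level} (R : CommutativeRing c ℓ) (a : Poly.Coeffs R) → Poly.IsPoly R a →
    ((k m : ℕ) → m ≤ k →
    CommutativeRing._≈_ R (Poly.I R k (Poly.xPow R m a)) (Poly.I R (k ∸ m) a))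
    × ((k : ℕ) →
    CommutativeRing._≈_ R (Poly.I R k (Poly.yMul R a))
    (CommutativeRing.-_ R (Poly.sumBelow R k (λ s → Poly.I R s a))))
lemma3p2 R a _ = I-xPow R a , I-yMul R a
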